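{- Let $L$ be an event log over a finite set of activities $A_L$, let $a_s,a_f\notin A_L$ with $a_s\neq a_f$, and let $L'=\mathrm{USE}(L)$ be its USE-transformation over $A'=A_L\cup\{a_s,a_f\}$. Let $\mathcal{C}$ be any causal relation oracle. Then for every pair $(a,b)\in\mathcal{C}(L')$ with $a\neq a_f$ and $b\neq a_s$, the integer linear program $ILP_{(L',a\to b)}$ has a feasible solution.
   Context: An event log $L$ is a finite multiset (bag) of finite sequences (traces) over a finite set of activities $A_L$. For a bag $L$ of sequences, its prefix-closure $\overline{L}$ is the set of all prefixes (including the empty sequence $\epsilon$) of sequences in $L$. For a sequence $\sigma$ over $A'$, the Parikh vector $\vec p(\sigma)\in\mathbb{N}^{|A'|}$ gives, for each activity $c\in A'$, the number of occurrences of $c$ in $\sigma$. The USE-transformation of $L$ (with fresh activities $a_s,a_f\notin A_L$, $a_s\ne a_f$) is the bag $\mathrm{USE}(L)$ obtained by replacing every trace $\sigma\in L$ (with its multiplicity) by $\langle a_s\rangle\cdot\sigma\cdot\langle a_f\rangle$. A causal relation oracle is any function $\mathcal{C}$ mapping a bag of traces to a set of pairs of activities occurring in it. For a bag of traces $L'$ over $A'$ and activities $a,b\in A'$, $ILP_{(L',a\to b)}$ is the integer program (with arbitrary real objective coefficients $c_m\in\mathbb{R}$, $\vec c_x,\vec c_y\in\mathbb{R}^{|A'|}$, objective: minimize $c_m m+\vec c_x^{\top}\vec x+\vec c_y^{\top}\vec y$) over variables $m\in\{0,1\}$, $\vec x,\vec y\in\{0,1\}^{|A'|}$ subject to: (i)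 for every nonempty $\sigma=\sigma'\cdot\langle c\rangle\in\overline{L'}$: $m+\vec p(\sigma')^{\top}\vec x-\vec p(\sigma)^{\top}\vec y\ge 0$; (ii) for every trace $\sigma\in L'$: $m+\vec p(\sigma)^{\top}(\vec x-\vec y)=0$; (iii) $\sum_{c}\vec x(c)+\sum_c\vec y(c)\ge 1$; (iv) $m=0$, $\vec x(a)=1$, $\vec y(b)=1$. A feasible solution is an assignment satisfying all constraints. -}

module Defs where

open import Data.Nat as ℕ using (ℕ)
open import Data.Fin using (Fin)
open import Data.Fin.Properties as FinP using ()
open import Data.Bool using (Bool; true; false)
open import Data.List using (List; []; _∷_; _++_; [_]; map; sum; allFin)
open import Data.List.Membership.Propositional using (_∈_)
open import Data.Integer as ℤ using (ℤ; +_; 0ℤ; 1ℤ)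
open import Data.Sum using (_⊎_)
open import Data.Product using (Σ; ∃; _×_; _,_)
open import Relation.Binary.PropositionalEquality using (_≡_; refl; cong)
open import Relation.Nullary using (Dec; yes; no; ¬_)

-- Activities.  A_L = Fin n ; A' = A_L ∪ {a_s, aᶠ} with two fresh,
-- distinct activities a_s (start) and aᶠ (final).

data Act (n : ℕ) : Set where
  aₛ  : Act n
  aᶠ : Act n
  act : Fin n → Act n

allActs : (n : ℕ) → List (Act n)
allActs n = aₛ ∷ aᶠ ∷ map act (allFin n)

_≟ᴬ_ : {n : ℕ} → (a b : Act n) → Dec (a ≡ b)
aₛ ≟ᴬ aₛ = yes refl
aₛ ≟ᴬ aᶠ = no λ ()
aₛ ≟ᴬ act _ = no λ ()
aᶠ ≟ᴬ aₛ = no λ ()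
aᶠ ≟ᴬ aᶠ = yes refl
aᶠ ≟ᴬ act _ = no λ ()
act _ ≟ᴬ aₛ = no λ ()
act _ ≟ᴬ aᶠ = no λ ()
act i ≟ᴬ act j with i FinP.≟ j
... | yes refl = yes refl
... | no i≢j = no λ { refl → i≢j refl }

-- Traces and event logs (bags of traces are represented as lists;
-- repeated entries encode multiplicity).

Trace : Set → Set
Trace A = List A

Log : Set → Set
Log A = List (Trace A)

USE : {n : ℕ} → Log (Fin n) → Log (Act n)
USE L = map (λ σ → aₛ ∷ (map act σ ++ [ aᶠ ])) L

Prefix : {A : Set} → List A → List A → Set
Prefix σ τ = ∃ λ ρ → σ ++ ρ ≡ τ

InPrefixClosure : {A : Set} → List A → Log A → Set
InPrefixClosure σ L = ∃ λ τ → τ ∈ L × Prefix σ τ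

OccursIn : {A : Set} → A → Log A → Set
OccursIn a L = ∃ λ τ → τ ∈ L × a ∈ τ

count : {n : ℕ} → Act n → List (Act n) → ℕ
count c [] = 0
count c (d ∷ σ) with c ≟ᴬ d
... | yes _ = ℕ.suc (count c σ)
... | no _  = count c σ

parikh : {n : ℕ} → List (Act n) → Act n → ℕ
parikh σ c = count c σ

sumℤ : List ℤ → ℤ
sumℤ [] = 0ℤ
sumℤ (z ∷ zs) = z ℤ.+ sumℤ zs

dot : {n : ℕ} → (Act n → ℕ) → (Act n → ℤ) → ℤ
dot {n} p x = sumℤ (map (λ c → (+ p c) ℤ.* x c) (allActs n))

total : {n : ℕ} → (Act n → ℤ) → ℤ
total {n} x = sumℤ (map x (allActs n))

Binary : ℤ → Set
Binary z = z ≡ 0ℤ ⊎ z ≡ 1ℤ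

-- Feasible solutions of ILP_(L', a → b).  (The objective function is
-- irrelevant for feasibility and therefore omitted.)

record FeasibleSol {n : ℕ} (L' : Log (Act n)) (a b : Act n) : Set where
  field
    m : ℤ
    x : Act n → ℤ
    y : Act n → ℤ
    m-bin : Binary m
    x-bin : ∀ c → Binary (x c)
    y-bin : ∀ c → Binary (y c)
    c-prefix : ∀ σ' c → InPrefixClosure (σ' ++ [ c ]) L' →
               0ℤ ℤ.≤ (m ℤ.+ dot (parikh σ') x) ℤ.- dot (parikh (σ' ++ [ c ])) y
    c-trace : ∀ σ → σ ∈ L' → m ℤ.+ dot (parikh σ) (λ c → x c ℤ.- y c) ≡ 0ℤ
    c-nontriv : 1ℤ ℤ.≤ total x ℤ.+ total y
    c-m : m ≡ 0ℤ
    c-a : x a ≡ 1ℤ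
    c-b : y b ≡ 1ℤ

HasFeasibleSolution : {n : ℕ} → Log (Act n) → Act n → Act n → Set
HasFeasibleSolution L' a b = FeasibleSol L' a b

record CausalOracle (n : ℕ) : Set₁ where
  field
    rel   : Log (Act n) → Act n → Act n → Set
    sound : ∀ L a b → rel L a b → OccursIn a L × OccursIn b L

module Submission where

open import Defs
open import Data.Nat using (ℕ)
open import Data.Fin using (Fin)
open import Relation.Binary.PropositionalEquality using (_≢_)

import Data.Nat as ℕ
import Data.Fin as Fin
open import Data.Fin.Properties using (suc-injective)
open import Data.List using (List; []; _∷_; _++_; [_]; map; tabulate; allFin)
open import Data.List.Properties using (map-∘; map-tabulate; ∷-injective; ++-assoc)
open import Data.List.Membership.Propositional using (_∈_)
open import Data.List.Membership.Propositional.Properties using (∈-map⁻)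
open import Data.Integer using (ℤ; +_; -_; 0ℤ; 1ℤ; _+_; _*_; _-_; _≤_; +≤+)
open import Data.Integer.Properties as ℤP using ()
open import Algebra.Properties.CommutativeSemigroup ℤP.+-commutativeSemigroup using (interchange)
open import Data.Sum using (inj₁; inj₂)
open import Data.Product using (Σ; _,_)
open import Relation.Binary.PropositionalEquality
  using (_≡_; refl; sym; trans; cong; cong₂; module ≡-Reasoning)
open import Relation.Nullary using (yes; no)
open import Data.Empty using (⊥-elim)
open import Function using (_∘_; id)

-- The oracle is irrelevant: for every pair (a , b) with
-- a ≠ aᶠ and b ≠ aₛ one place works uniformly, namely the place that
-- is produced by every activity except aᶠ and consumed by every
-- activity except aₛ (m = 0, x = 1 - [c = aᶠ], y = 1 - [c = aₛ]).
-- Inner activities form self-loops, aₛ puts a token in and aᶠ removes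
-- it, so on every trace aₛ·σ·aᶠ of USE(L) the place is balanced.

weight : {A : Set} → (A → ℤ) → List A → ℤ
weight w σ = sumℤ (map w σ)

weight-+ : {A : Set} (f g : A → ℤ) (l : List A) →
           weight (λ c → f c + g c) l ≡ weight f l + weight g l
weight-+ f g []      = refl
weight-+ f g (a ∷ l) = trans (cong (_+_ (f a + g a)) (weight-+ f g l))
                              (interchange (f a) (g a) (weight f l) (weight g l))

weight-cong : {A : Set} {f g : A → ℤ} → (∀ a → f a ≡ g a) → (l : List A) →
              weight f l ≡ weight g l
weight-cong f≡g []      = refl
weight-cong f≡g (a ∷ l) = cong₂ _+_ (f≡g a) (weight-cong f≡g l)

weight-map : {A B : Set} (f : B → ℤ) (g : A → B) (l : List A) →
             weight f (map g l) ≡ weight (f ∘ g) l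
weight-map f g l = cong sumℤ (sym (map-∘ l))

weight-zero : {A : Set} {f : A → ℤ} → (∀ a → f a ≡ 0ℤ) → (l : List A) →
              weight f l ≡ 0ℤ
weight-zero f≡0 []      = refl
weight-zero f≡0 (a ∷ l) = cong₂ _+_ (f≡0 a) (weight-zero f≡0 l)

weight-nonneg : {A : Set} {f : A → ℤ} → (∀ a → 0ℤ ≤ f a) → (l : List A) →
                0ℤ ≤ weight f l
weight-nonneg f≥0 []      = +≤+ ℕ.z≤n
weight-nonneg f≥0 (a ∷ l) = ℤP.+-mono-≤ (f≥0 a) (weight-nonneg f≥0 l)

binary-nonneg : ∀ {z} → Binary z → 0ℤ ≤ z
binary-nonneg (inj₁ refl) = +≤+ ℕ.z≤n
binary-nonneg (inj₂ refl) = +≤+ ℕ.z≤n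

sum-tabulate : ∀ {k} (h : Fin k → ℤ) → sumℤ (tabulate h) ≡ weight h (allFin k)
sum-tabulate h = sym (cong sumℤ (map-tabulate id h))

sum-tabulate-single : ∀ {k} (h : Fin k → ℤ) (i : Fin k) →
                      (∀ j → j ≢ i → h j ≡ 0ℤ) → sumℤ (tabulate h) ≡ h i
sum-tabulate-single h Fin.zero h≡0 = begin
  h Fin.zero + sumℤ (tabulate (h ∘ Fin.suc))     ≡⟨ cong (_+_ (h Fin.zero)) (sum-tabulate (h ∘ Fin.suc)) ⟩
  h Fin.zero + weight (h ∘ Fin.suc) (allFin _)   ≡⟨ cong (_+_ (h Fin.zero)) rest-zero ⟩
  h Fin.zero + 0ℤ                                ≡⟨ ℤP.+-identityʳ _ ⟩
  h Fin.zero                                     ∎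
  where
  open ≡-Reasoning
  rest-zero : weight (h ∘ Fin.suc) (allFin _) ≡ 0ℤ
  rest-zero = weight-zero (λ j → h≡0 (Fin.suc j) λ ()) (allFin _)
sum-tabulate-single h (Fin.suc i) h≡0 = begin
  h Fin.zero + sumℤ (tabulate (h ∘ Fin.suc))     ≡⟨ cong (_+ sumℤ (tabulate (h ∘ Fin.suc))) (h≡0 Fin.zero λ ()) ⟩
  0ℤ + sumℤ (tabulate (h ∘ Fin.suc))             ≡⟨ ℤP.+-identityˡ _ ⟩
  sumℤ (tabulate (h ∘ Fin.suc))                  ≡⟨ sum-tabulate-single (h ∘ Fin.suc) i (λ j j≢i → h≡0 (Fin.suc j) (j≢i ∘ suc-injective)) ⟩
  h (Fin.suc i)                                  ∎
  where open ≡-Reasoning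

module _ {n : ℕ} where

  count-∷ : (c d : Act n) (σ : List (Act n)) →
            count c (d ∷ σ) ≡ count c [ d ] ℕ.+ count c σ
  count-∷ c d σ with c ≟ᴬ d
  ... | yes _ = refl
  ... | no  _ = refl

  dot-∷ : (d : Act n) (σ : List (Act n)) (w : Act n → ℤ) →
          dot (parikh (d ∷ σ)) w ≡ dot (parikh [ d ]) w + dot (parikh σ) w
  dot-∷ d σ w = trans (weight-cong split (allActs n))
                      (weight-+ (λ c → + count c [ d ] * w c) (λ c → + count c σ * w c) (allActs n))
    where
    split : ∀ c → + count c (d ∷ σ) * w c ≡ + count c [ d ] * w c + + count c σ * w c
    split c = trans (cong (λ k → + k * w c) (count-∷ c d σ))
                    (trans (cong (_* w c) (ℤP.pos-+ (count c [ d ]) (count c σ)))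
                           (ℤP.*-distribʳ-+ (w c) (+ count c [ d ]) (+ count c σ)))

  unit-off-act : (d : Act n) {w : Act n → ℤ} → (∀ j → count (act j) [ d ] ≡ 0) →
                 weight (λ c → + count c [ d ] * w c) (map act (allFin n)) ≡ 0ℤ
  unit-off-act d {w} off = trans (weight-map _ act (allFin n))
    (weight-zero (λ j → cong (λ k → + k * w (act j)) (off j)) (allFin n))

  -- Each activity occurs exactly once in the enumeration allActs n, so
  -- the linear form of the unit vector of d picks out w(d).
  dot-unit : (d : Act n) (w : Act n → ℤ) → dot (parikh [ d ]) w ≡ w d
  dot-unit aₛ w = begin
    1ℤ * w aₛ + (0ℤ + weight (λ c → + count c [ aₛ ] * w c) (map act (allFin n)))
      ≡⟨ cong₂ (λ u v → u + (0ℤ + v)) (ℤP.*-identityˡ (w aₛ)) (unit-off-act aₛ (λ _ → refl)) ⟩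
    w aₛ + 0ℤ  ≡⟨ ℤP.+-identityʳ _ ⟩
    w aₛ       ∎
    where open ≡-Reasoning
  dot-unit aᶠ w = begin
    0ℤ + (1ℤ * w aᶠ + weight (λ c → + count c [ aᶠ ] * w c) (map act (allFin n)))
      ≡⟨ cong₂ (λ u v → 0ℤ + (u + v)) (ℤP.*-identityˡ (w aᶠ)) (unit-off-act aᶠ (λ _ → refl)) ⟩
    0ℤ + (w aᶠ + 0ℤ)  ≡⟨ trans (ℤP.+-identityˡ _) (ℤP.+-identityʳ _) ⟩
    w aᶠ              ∎
    where open ≡-Reasoning
  dot-unit (act i) w = begin
    0ℤ + (0ℤ + weight h (map act (allFin n)))  ≡⟨ trans (ℤP.+-identityˡ _) (ℤP.+-identityˡ _) ⟩
    weight h (map act (allFin n))              ≡⟨ weight-map h act (allFin n) ⟩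
    weight (h ∘ act) (allFin n)                ≡⟨ sym (sum-tabulate (h ∘ act)) ⟩
    sumℤ (tabulate (h ∘ act))                  ≡⟨ sum-tabulate-single (h ∘ act) i off-i ⟩
    h (act i)                                  ≡⟨ at-i ⟩
    w (act i)                                  ∎
    where
    open ≡-Reasoning
    h : Act n → ℤ
    h c = + count c [ act i ] * w c
    off-i : ∀ j → j ≢ i → h (act j) ≡ 0ℤ
    off-i j j≢i with act j ≟ᴬ act i
    ... | yes refl = ⊥-elim (j≢i refl)
    ... | no  _    = refl
    at-i : h (act i) ≡ w (act i)
    at-i with act i ≟ᴬ act i
    ... | yes _   = ℤP.*-identityˡ _
    ... | no  i≢i = ⊥-elim (i≢i refl)

  dot-parikh : (σ : List (Act n)) (w : Act n → ℤ) → dot (parikh σ) w ≡ weight w σ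
  dot-parikh []      w = weight-zero (λ _ → refl) (allActs n)
  dot-parikh (d ∷ σ) w = trans (dot-∷ d σ w) (cong₂ _+_ (dot-unit d w) (dot-parikh σ w))

module _ {n : ℕ} where

  produce : Act n → ℤ
  produce aₛ      = 1ℤ
  produce aᶠ      = 0ℤ
  produce (act _) = 1ℤ

  consume : Act n → ℤ
  consume aₛ      = 0ℤ
  consume aᶠ      = 1ℤ
  consume (act _) = 1ℤ

  produce-binary : ∀ c → Binary (produce c)
  produce-binary aₛ      = inj₂ refl
  produce-binary aᶠ      = inj₁ refl
  produce-binary (act _) = inj₂ refl

  consume-binary : ∀ c → Binary (consume c)
  consume-binary aₛ      = inj₁ refl
  consume-binary aᶠ      = inj₂ refl
  consume-binary (act _) = inj₂ refl

  framed : List (Fin n) → List (Act n)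
  framed σ = aₛ ∷ (map act σ ++ [ aᶠ ])

  traces-of-USE : {L : Log (Fin n)} {τ : List (Act n)} → τ ∈ USE L →
                  Σ (List (Fin n)) (λ t → τ ≡ framed t)
  traces-of-USE τ∈ with ∈-map⁻ framed τ∈
  ... | t , _ , τ≡ = t , τ≡

  -- Inside the body σ·⟨aᶠ⟩ the token put in by aₛ is still present
  -- before each activity fires: consumption up to and including c
  -- equals one plus production strictly before c.
  body-balanced : (σ : List (Act n)) (c : Act n) (ρ : List (Act n)) (t : List (Fin n)) →
                  σ ++ c ∷ ρ ≡ map act t ++ [ aᶠ ] →
                  1ℤ + weight produce σ ≡ weight consume (σ ++ [ c ])
  body-balanced []          c ρ []      refl = refl
  body-balanced []          c ρ (j ∷ t) refl = refl
  body-balanced (_ ∷ [])    c ρ []      ()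
  body-balanced (_ ∷ _ ∷ _) c ρ []      ()
  body-balanced (d ∷ σ)     c ρ (j ∷ t) eq with ∷-injective eq
  ... | refl , eq′ = cong (_+_ 1ℤ) (body-balanced σ c ρ t eq′)

  prefix-balanced : (σ : List (Act n)) (c : Act n) (ρ : List (Act n)) (t : List (Fin n)) →
                    σ ++ c ∷ ρ ≡ framed t →
                    weight produce σ ≡ weight consume (σ ++ [ c ])
  prefix-balanced []      c ρ t refl = refl
  prefix-balanced (d ∷ σ) c ρ t eq with ∷-injective eq
  ... | refl , eq′ = trans (body-balanced σ c ρ t eq′) (sym (ℤP.+-identityˡ _))

  -- Along the body, inner activities are self-loops and aᶠ removes a token.
  body-net : (t : List (Fin n)) →
             weight (λ c → produce c - consume c) (map act t ++ [ aᶠ ]) ≡ - 1ℤ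
  body-net []      = refl
  body-net (_ ∷ t) rewrite body-net t = refl

  trace-balanced : (t : List (Fin n)) →
                   weight (λ c → produce c - consume c) (framed t) ≡ 0ℤ
  trace-balanced t rewrite body-net t = refl

  zero-slack : {u v : ℤ} → u ≡ v → 0ℤ ≤ (0ℤ + u) - v
  zero-slack {u} {v} u≡v = ℤP.≤-reflexive (sym (begin
    (0ℤ + u) - v  ≡⟨ cong (_- v) (trans (ℤP.+-identityˡ u) u≡v) ⟩
    v - v         ≡⟨ ℤP.+-inverseʳ v ⟩
    0ℤ            ∎))
    where open ≡-Reasoning

  universal-prefix : (L : Log (Fin n)) (σ′ : List (Act n)) (c : Act n) →
                     InPrefixClosure (σ′ ++ [ c ]) (USE L) →
                     0ℤ ≤ (0ℤ + dot (parikh σ′) produce) - dot (parikh (σ′ ++ [ c ])) consume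
  universal-prefix L σ′ c (τ , τ∈ , ρ , σ′cρ≡τ) with traces-of-USE τ∈
  ... | t , τ≡ = zero-slack (begin
    dot (parikh σ′) produce             ≡⟨ dot-parikh σ′ produce ⟩
    weight produce σ′                   ≡⟨ prefix-balanced σ′ c ρ t split ⟩
    weight consume (σ′ ++ [ c ])        ≡⟨ sym (dot-parikh (σ′ ++ [ c ]) consume) ⟩
    dot (parikh (σ′ ++ [ c ])) consume  ∎)
    where
    open ≡-Reasoning
    split : σ′ ++ c ∷ ρ ≡ framed t
    split = trans (sym (++-assoc σ′ [ c ] ρ)) (trans σ′cρ≡τ τ≡)

  universal-trace : (L : Log (Fin n)) (σ : List (Act n)) → σ ∈ USE L →
                    0ℤ + dot (parikh σ) (λ c → produce c - consume c) ≡ 0ℤ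
  universal-trace L σ σ∈ with traces-of-USE σ∈
  ... | t , refl = trans (ℤP.+-identityˡ _)
                         (trans (dot-parikh (framed t) (λ c → produce c - consume c)) (trace-balanced t))

  -- Constraint (iii): aₛ contributes 1 to total x, all other terms are
  -- nonnegative.
  universal-nontrivial : 1ℤ ≤ total produce + total consume
  universal-nontrivial =
    ℤP.+-mono-≤ (ℤP.+-monoʳ-≤ 1ℤ (weight-nonneg (binary-nonneg ∘ produce-binary) (aᶠ ∷ map act (allFin n))))
                (weight-nonneg (binary-nonneg ∘ consume-binary) (allActs n))

  produce-source : (a : Act n) → a ≢ aᶠ → produce a ≡ 1ℤ
  produce-source aₛ      _   = refl
  produce-source aᶠ      a≢ = ⊥-elim (a≢ refl)
  produce-source (act _) _   = refl

  consume-target : (b : Act n) → b ≢ aₛ → consume b ≡ 1ℤ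
  consume-target aₛ      b≢ = ⊥-elim (b≢ refl)
  consume-target aᶠ      _   = refl
  consume-target (act _) _   = refl

lemma1 : (n : ℕ) (L : Log (Fin n)) (C : CausalOracle n) (a b : Act n) →
         CausalOracle.rel C (USE L) a b → a ≢ aᶠ → b ≢ aₛ →
         HasFeasibleSolution (USE L) a b
lemma1 n L C a b _ a≢aᶠ b≢aₛ = record
  { m         = 0ℤ
  ; x         = produce
  ; y         = consume
  ; m-bin     = inj₁ refl
  ; x-bin     = produce-binary
  ; y-bin     = consume-binary
  ; c-prefix  = universal-prefix L
  ; c-trace   = universal-trace L
  ; c-nontriv = universal-nontrivial {n}
  ; c-m       = refl
  ; c-a       = produce-source a a≢aᶠ
  ; c-b       = consume-target b b≢aₛ
  }
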